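{- Up to isomorphism, the two-way-infinite path $P_\infty$ is the only vertex-transitive graph that has exactly one two-way-infinite hamiltonian path.
   Context: A graph $X$ is vertex-transitive if its automorphism group acts transitively on $V(X)$. The two-way-infinite path $P_\infty$ is the graph with vertex set $\mathbb{Z}$ in which $i$ is adjacent to $j$ iff $|i-j|=1$. A two-way-infinite hamiltonian path in a countably infinite graph $X$ is a two-way-infinite list $\ldots,x_{ -2},x_{ -1},x_0,x_1,x_2,\ldots$ of all vertices of $X$, each appearing exactly once, such that $x_i$ is adjacent to $x_{i+1}$ for every $i\in\mathbb{Z}$; two such lists are regarded as the same path if they have the same underlying subgraph (set of edges $x_i x_{i+1}$). -}

module Defs where

open import Data.Nat using (ℕ)
open import Data.Integer using (ℤ; _+_; _-_; ∣_∣; 1ℤ)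
open import Data.Product using (Σ; ∃; _×_; _,_)
open import Data.Sum using (_⊎_)
open import Data.Empty using (⊥)
open import Function.Bundles using (_⤖_; _⇔_; Bijection)
open import Function.Definitions using (Bijective)
open import Relation.Binary.PropositionalEquality using (_≡_)

record Graph : Set₁ where
  field
    V     : Set
    Adj   : V → V → Set
    sym   : ∀ {u v} → Adj u v → Adj v u
    irrefl : ∀ {v} → Adj v v → ⊥
open Graph public

CountablyInfinite : Graph → Set
CountablyInfinite X = V X ⤖ ℕ

record Automorphism (X : Graph) : Set where
  field
    σ        : V X ⤖ V X
    preserve : ∀ u v → Adj X u v ⇔ Adj X (Bijection.to σ u) (Bijection.to σ v)
open Automorphism public

VertexTransitive : Graph → Set
VertexTransitive X =
  ∀ u v → Σ (Automorphism X) λ a → Bijection.to (σ a) u ≡ v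

P∞ : Graph
P∞ = record
  { V = ℤ
  ; Adj = λ i j → ∣ i - j ∣ ≡ 1
  ; sym = λ {i} {j} → symP {i} {j}
  ; irrefl = λ {i} → irreflP {i}
  }
  where
  open import Data.Integer.Properties using (∣i-j∣≡∣j-i∣; i≡j⇒i-j≡0)
  open import Relation.Binary.PropositionalEquality as P using (trans; refl)
  symP : ∀ {i j : ℤ} → ∣ i - j ∣ ≡ 1 → ∣ j - i ∣ ≡ 1
  symP {i} {j} e = trans (∣i-j∣≡∣j-i∣ j i) e
  irreflP : ∀ {i : ℤ} → ∣ i - i ∣ ≡ 1 → ⊥
  irreflP {i} e with trans (P.sym (P.cong ∣_∣ (i≡j⇒i-j≡0 {i} refl))) e
  ... | ()

record HamPath (X : Graph) : Set where
  field
    walk     : ℤ → V X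
    bijective : Bijective _≡_ _≡_ walk
    adjacent : ∀ i → Adj X (walk i) (walk (i + 1ℤ))
open HamPath public

PathEdge : {X : Graph} → HamPath X → V X → V X → Set
PathEdge p u v = ∃ λ i →
  (walk p i ≡ u × walk p (i + 1ℤ) ≡ v) ⊎ (walk p i ≡ v × walk p (i + 1ℤ) ≡ u)

SamePath : {X : Graph} → HamPath X → HamPath X → Set
SamePath p q = ∀ u v → PathEdge p u v ⇔ PathEdge q u v

UniqueHamPath : Graph → Set
UniqueHamPath X = Σ (HamPath X) λ p → ∀ (q : HamPath X) → SamePath p q

record _≅_ (X Y : Graph) : Set where
  field
    iso      : V X ⤖ V Y
    preserve : ∀ u v → Adj X u v ⇔ Adj Y (Bijection.to iso u) (Bijection.to iso v)

-- Read X through its unique hamiltonian path p : ℤ → V and write i ∼ j when p i and p j are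
-- adjacent. An automorphism a sends p to a hamiltonian path with the same edges, so p⁻¹ ∘ a ∘ p
-- is a translation or a reflection of ℤ preserving ∼; by vertex-transitivity, for every n one of
-- them sends 0 to n, and composing these shows that every translation by an even amount
-- preserves ∼. If some i ∼ i + D with D ≥ 2, this yields edges of length D at every start of one
-- parity, and at every start when D is even. Cutting ℤ into blocks of length D + 1 and running
-- through each block as 1, 0, D, D - 1, …, 2 then gives a second hamiltonian path, which uses
-- such edges. Hence i ∼ j exactly when |i - j| = 1, and p⁻¹ : X ≅ P∞. For P∞ itself, translations
-- act transitively and every hamiltonian path is a translation or a reflection of ℤ, so it has
-- the same edges as the identity.
module Submission where

open import Defs hiding (sym)
open import Data.Nat as ℕ using (ℕ; zero; suc; _∸_; z≤n; s≤s)
import Data.Nat.Properties as ℕ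
open import Data.Integer as ℤ
  using (ℤ; +_; -[1+_]; +<+; 0ℤ; 1ℤ; -1ℤ; _+_; _-_; -_; _*_; ∣_∣; _%ℕ_; _/ℕ_; _<_)
open import Data.Integer.Properties
open import Data.Integer.DivMod using (a≡a%ℕn+[a/ℕn]*n; n%ℕd<d)
open import Algebra.Properties.AbelianGroup +-0-abelianGroup using (∙-cancelʳ)
open import Data.Integer.Tactic.RingSolver using (solve-∀)
open import Data.Product using (∃-syntax; _×_; _,_; proj₁)
open import Data.Sum using (_⊎_; inj₁; inj₂)
open import Data.Empty using (⊥-elim)
open import Function.Base using (_∘_)
open import Function.Definitions using (Injective)
open import Function.Bundles using (Inverse; _↔_; _⇔_; mk⤖; mk↔ₛ′; mk⇔; Equivalence; Bijection)
open import Function.Properties.Inverse using (↔⇒⤖)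
open import Function.Properties.Bijection using (⤖⇒↔)
open import Function.Construct.Composition using (_↔-∘_; _⇔-∘_)
open import Function.Construct.Symmetry using (↔-sym; ⇔-sym)
open import Function.Construct.Identity using (↔-id)
open import Relation.Nullary using (¬_)
open import Relation.Binary.Definitions using (tri<; tri≈; tri>)
open import Relation.Binary.PropositionalEquality
  using (_≡_; _≢_; refl; cong; cong₂; sym; trans; subst; subst₂; module ≡-Reasoning)

+n+1≡+[1+n] : ∀ n → + n + 1ℤ ≡ + suc n
+n+1≡+[1+n] n = trans (sym (pos-+ n 1)) (cong +_ (ℕ.+-comm n 1))

step-invariant⇒constant : {A : Set} (g : ℤ → A) →
  (∀ t → g (t + 1ℤ) ≡ g t) → ∀ t → g t ≡ g 0ℤ
step-invariant⇒constant g step (+ zero)      = refl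
step-invariant⇒constant g step (+ suc n)     =
  trans (cong g (sym (+n+1≡+[1+n] n))) (trans (step (+ n)) (step-invariant⇒constant g step (+ n)))
step-invariant⇒constant g step -[1+ zero ]   = sym (step -1ℤ)
step-invariant⇒constant g step -[1+ suc n ]  =
  trans (sym (step -[1+ suc n ])) (step-invariant⇒constant g step -[1+ n ])

even-or-odd : ∀ z → ∃[ n ] (z ≡ n + n ⊎ z ≡ n + n + 1ℤ)
even-or-odd z with z %ℕ 2 | n%ℕd<d z 2 | a≡a%ℕn+[a/ℕn]*n z 2
... | 0           | _             | z≡ = z /ℕ 2 , inj₁ (trans z≡ (halves (z /ℕ 2)))
  where halves : ∀ n → + 0 + n * + 2 ≡ n + n
        halves = solve-∀
... | 1           | _             | z≡ = z /ℕ 2 , inj₂ (trans z≡ (halves (z /ℕ 2)))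
  where halves : ∀ n → + 1 + n * + 2 ≡ n + n + 1ℤ
        halves = solve-∀
... | suc (suc _) | s≤s (s≤s ()) | _

i-j≡k⇒k+j≡i : ∀ {i j k} → i - j ≡ k → k + j ≡ i
i-j≡k⇒k+j≡i {i} {j} refl = [i-j]+j≡i i j
  where [i-j]+j≡i : ∀ i j → i - j + j ≡ i
        [i-j]+j≡i = solve-∀

∣i∣≡1⇒i≡±1 : ∀ {i} → ∣ i ∣ ≡ 1 → i ≡ 1ℤ ⊎ i ≡ -1ℤ
∣i∣≡1⇒i≡±1 {+ 1}        refl = inj₁ refl
∣i∣≡1⇒i≡±1 { -[1+ 0 ]}  refl = inj₂ refl

unit-steps-equal : ∀ {a b} → ∣ a ∣ ≡ 1 → ∣ b ∣ ≡ 1 → a + b ≢ 0ℤ → a ≡ b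
unit-steps-equal {a} {b} ∣a∣≡1 ∣b∣≡1 a+b≢0 with ∣i∣≡1⇒i≡±1 {a} ∣a∣≡1 | ∣i∣≡1⇒i≡±1 {b} ∣b∣≡1
... | inj₁ refl | inj₁ refl = refl
... | inj₁ refl | inj₂ refl = ⊥-elim (a+b≢0 refl)
... | inj₂ refl | inj₁ refl = ⊥-elim (a+b≢0 refl)
... | inj₂ refl | inj₂ refl = refl

t+2≢t : ∀ t → t + 1ℤ + 1ℤ ≢ t
t+2≢t t eq with trans (sym (t+2-t≡2 t)) (trans (cong (_- t) eq) (+-inverseʳ t))
  where t+2-t≡2 : ∀ t → t + 1ℤ + 1ℤ - t ≡ + 2
        t+2-t≡2 = solve-∀
... | ()

constant-step⇒affine : ∀ (f : ℤ → ℤ) {d} → (∀ t → d + f t ≡ f (t + 1ℤ)) → ∀ t → f t ≡ f 0ℤ + t * d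
constant-step⇒affine f {d} step t = begin
  f t                      ≡⟨ i-j≡k⇒k+j≡i {f t} {t * d} refl ⟨
  g t + t * d              ≡⟨ cong (_+ t * d) (step-invariant⇒constant g g-step t) ⟩
  f 0ℤ - 0ℤ * d + t * d    ≡⟨ cong (λ x → x + t * d) (+-identityʳ (f 0ℤ)) ⟩
  f 0ℤ + t * d             ∎
  where
  open ≡-Reasoning
  g : ℤ → ℤ
  g s = f s - s * d
  g-step : ∀ s → g (s + 1ℤ) ≡ g s
  g-step s = trans (cong (λ x → x - (s + 1ℤ) * d) (sym (step s))) (cancel d (f s) s)
    where cancel : ∀ d a s → d + a - (s + 1ℤ) * d ≡ a - s * d
          cancel = solve-∀

Rigid : (ℤ → ℤ) → Set
Rigid f = (∀ t → f t ≡ f 0ℤ + t) ⊎ (∀ t → f t ≡ f 0ℤ - t)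

-- The steps f (t + 1) - f t are ±1, and two consecutive ones cannot cancel since f (t + 2) ≢ f t;
-- so they are all equal and f is affine with slope ±1.
injective-unit-steps⇒rigid : ∀ {f} → Injective _≡_ _≡_ f →
  (∀ t → Adj P∞ (f t) (f (t + 1ℤ))) → Rigid f
injective-unit-steps⇒rigid {f} f-inj unit = rigid (∣i∣≡1⇒i≡±1 (∣δ∣≡1 0ℤ))
  where
  δ : ℤ → ℤ
  δ t = f (t + 1ℤ) - f t

  ∣δ∣≡1 : ∀ t → ∣ δ t ∣ ≡ 1
  ∣δ∣≡1 t = trans (∣i-j∣≡∣j-i∣ (f (t + 1ℤ)) (f t)) (unit t)

  δ-step : ∀ t → δ (t + 1ℤ) ≡ δ t
  δ-step t = unit-steps-equal (∣δ∣≡1 (t + 1ℤ)) (∣δ∣≡1 t) no-return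
    where
    no-return : δ (t + 1ℤ) + δ t ≢ 0ℤ
    no-return eq = t+2≢t t (f-inj (i-j≡0⇒i≡j _ _
      (trans (sym (+-minus-telescope (f (t + 1ℤ + 1ℤ)) (f (t + 1ℤ)) (f t))) eq)))

  f≡affine : ∀ t → f t ≡ f 0ℤ + t * δ 0ℤ
  f≡affine = constant-step⇒affine f λ t → i-j≡k⇒k+j≡i (step-invariant⇒constant δ δ-step t)

  rigid : δ 0ℤ ≡ 1ℤ ⊎ δ 0ℤ ≡ -1ℤ → Rigid f
  rigid (inj₁ δ≡1)  = inj₁ λ t →
    trans (f≡affine t) (cong (λ x → f 0ℤ + x) (trans (cong (t *_) δ≡1) (*-identityʳ t)))
  rigid (inj₂ δ≡-1) = inj₂ λ t →
    trans (f≡affine t) (cong (λ x → f 0ℤ + x) (trans (cong (t *_) δ≡-1) (trans (*-comm t -1ℤ) (-1*i≡-i t))))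

P∞-adj-next : ∀ i → Adj P∞ i (i + 1ℤ)
P∞-adj-next i = cong ∣_∣ (i-[i+1]≡-1 i)
  where i-[i+1]≡-1 : ∀ i → i - (i + 1ℤ) ≡ -1ℤ
        i-[i+1]≡-1 = solve-∀

P∞-adj-prev : ∀ i → Adj P∞ (i + 1ℤ) i
P∞-adj-prev i = Graph.sym P∞ {i} (P∞-adj-next i)

P∞-adj⇒consecutive : ∀ {a b} → Adj P∞ a b → b ≡ a + 1ℤ ⊎ a ≡ b + 1ℤ
P∞-adj⇒consecutive {a} {b} ∣a-b∣≡1 with ∣i∣≡1⇒i≡±1 {a - b} ∣a-b∣≡1
... | inj₁ a-b≡1  = inj₂ (trans (sym (i-j≡k⇒k+j≡i a-b≡1)) (+-comm 1ℤ b))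
... | inj₂ a-b≡-1 = inj₁ (trans (b≡a-[a-b] a b) (cong (_-_ a) a-b≡-1))
  where b≡a-[a-b] : ∀ a b → b ≡ a - (a - b)
        b≡a-[a-b] = solve-∀

module _ {X : Graph} where

  walk↔ : HamPath X → ℤ ↔ V X
  walk↔ p = ⤖⇒↔ (mk⤖ (bijective p))

  index : HamPath X → V X → ℤ
  index p = Inverse.from (walk↔ p)

  walk∘index : (p : HamPath X) → ∀ u → walk p (index p u) ≡ u
  walk∘index p = Inverse.strictlyInverseˡ (walk↔ p)

  index∘walk : (p : HamPath X) → ∀ i → index p (walk p i) ≡ i
  index∘walk p = Inverse.strictlyInverseʳ (walk↔ p)

  hamPath : (β : ℤ ↔ V X) →
    (∀ i → Adj X (Inverse.to β i) (Inverse.to β (i + 1ℤ))) → HamPath X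
  hamPath β adj = record
    { walk = Inverse.to β
    ; bijective = Bijection.bijective (↔⇒⤖ β)
    ; adjacent = adj
    }

  pathEdge-sym : (p : HamPath X) → ∀ {u v} → PathEdge p u v → PathEdge p v u
  pathEdge-sym p (i , inj₁ e) = i , inj₂ e
  pathEdge-sym p (i , inj₂ e) = i , inj₁ e

  pathEdge⇒adj : (p : HamPath X) → ∀ {u v} → PathEdge p u v → Adj X u v
  pathEdge⇒adj p (i , inj₁ (refl , refl)) = adjacent p i
  pathEdge⇒adj p (i , inj₂ (refl , refl)) = Graph.sym X (adjacent p i)

  pathEdge⇔adj-index : (p : HamPath X) → ∀ u v →
    PathEdge p u v ⇔ Adj P∞ (index p u) (index p v)
  pathEdge⇔adj-index p u v = mk⇔ to from
    where
    to : PathEdge p u v → Adj P∞ (index p u) (index p v)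
    to (i , inj₁ (refl , refl)) =
      subst₂ (Adj P∞) (sym (index∘walk p i)) (sym (index∘walk p (i + 1ℤ))) (P∞-adj-next i)
    to (i , inj₂ (refl , refl)) =
      subst₂ (Adj P∞) (sym (index∘walk p (i + 1ℤ))) (sym (index∘walk p i)) (P∞-adj-prev i)
    from : Adj P∞ (index p u) (index p v) → PathEdge p u v
    from adj with P∞-adj⇒consecutive {index p u} {index p v} adj
    ... | inj₁ v-next = index p u , inj₁ (walk∘index p u , trans (cong (walk p) (sym v-next)) (walk∘index p v))
    ... | inj₂ u-next = index p v , inj₂ (walk∘index p v , trans (cong (walk p) (sym u-next)) (walk∘index p u))

relabel : ∀ {X} (p q : HamPath X) → SamePath p q → HamPath P∞
relabel p q same = hamPath (↔-sym (walk↔ p) ↔-∘ walk↔ q) λ i →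
  Equivalence.to (pathEdge⇔adj-index p _ _)
    (Equivalence.from (same (walk q i) (walk q (i + 1ℤ))) (i , inj₁ (refl , refl)))

mapHamPath : ∀ {X} → Automorphism X → HamPath X → HamPath X
mapHamPath a p = hamPath (⤖⇒↔ (σ a) ↔-∘ walk↔ p) λ i →
  Equivalence.to (preserve a (walk p i) (walk p (i + 1ℤ))) (adjacent p i)

translation : ℤ → Automorphism P∞
translation k = record
  { σ = ↔⇒⤖ (mk↔ₛ′ (_+ k) (_- k) (λ t → [t-k]+k≡t t k) (λ t → [t+k]-k≡t t k))
  ; preserve = λ a b → mk⇔ (trans (shift-invariant a b)) (trans (sym (shift-invariant a b)))
  }
  where
  [t-k]+k≡t : ∀ t k → t - k + k ≡ t
  [t-k]+k≡t = solve-∀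
  [t+k]-k≡t : ∀ t k → t + k - k ≡ t
  [t+k]-k≡t = solve-∀
  [a+k]-[b+k]≡a-b : ∀ a b k → (a + k) - (b + k) ≡ a - b
  [a+k]-[b+k]≡a-b = solve-∀
  shift-invariant : ∀ a b → ∣ (a + k) - (b + k) ∣ ≡ ∣ a - b ∣
  shift-invariant a b = cong ∣_∣ ([a+k]-[b+k]≡a-b a b k)

P∞-vertexTransitive : VertexTransitive P∞
P∞-vertexTransitive u v = translation (v - u) , u+[v-u]≡v u v
  where u+[v-u]≡v : ∀ u v → u + (v - u) ≡ v
        u+[v-u]≡v = solve-∀

P∞-pathEdge⇔adj : (q : HamPath P∞) → ∀ u v → PathEdge q u v ⇔ Adj P∞ u v
P∞-pathEdge⇔adj q u v = mk⇔ (pathEdge⇒adj q) from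
  where
  edge-to-next : ∀ u → PathEdge q u (u + 1ℤ)
  edge-to-next u with injective-unit-steps⇒rigid (proj₁ (bijective q)) (adjacent q)
  ... | inj₁ shift = u - q₀ , inj₁ (trans (shift _) (q₀+[u-q₀]≡u q₀ u) , trans (shift _) (q₀+[u-q₀+1]≡u+1 q₀ u))
    where
    q₀ = walk q 0ℤ
    q₀+[u-q₀]≡u : ∀ q₀ u → q₀ + (u - q₀) ≡ u
    q₀+[u-q₀]≡u = solve-∀
    q₀+[u-q₀+1]≡u+1 : ∀ q₀ u → q₀ + (u - q₀ + 1ℤ) ≡ u + 1ℤ
    q₀+[u-q₀+1]≡u+1 = solve-∀
  ... | inj₂ flip = q₀ - u - 1ℤ , inj₂ (trans (flip _) (q₀-[q₀-u-1]≡u+1 q₀ u) , trans (flip _) (q₀-[q₀-u-1+1]≡u q₀ u))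
    where
    q₀ = walk q 0ℤ
    q₀-[q₀-u-1]≡u+1 : ∀ q₀ u → q₀ - (q₀ - u - 1ℤ) ≡ u + 1ℤ
    q₀-[q₀-u-1]≡u+1 = solve-∀
    q₀-[q₀-u-1+1]≡u : ∀ q₀ u → q₀ - (q₀ - u - 1ℤ + 1ℤ) ≡ u
    q₀-[q₀-u-1+1]≡u = solve-∀
  from : Adj P∞ u v → PathEdge q u v
  from adj with P∞-adj⇒consecutive {u} {v} adj
  ... | inj₁ refl = edge-to-next u
  ... | inj₂ refl = pathEdge-sym q (edge-to-next v)

P∞-uniqueHamPath : UniqueHamPath P∞
P∞-uniqueHamPath = identity , λ q u v → ⇔-sym (P∞-pathEdge⇔adj q u v) ⇔-∘ P∞-pathEdge⇔adj identity u v
  where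
  identity : HamPath P∞
  identity = hamPath (↔-id ℤ) P∞-adj-next

-- ρ permutes each block [j M, j M + M) so that it is traversed at offsets 1, 0, M - 1, …, 2.
-- Consecutive values of ρ then differ by 1, except for the two jumps of length D = M - 1
-- leaving offsets 0 and 2.
module Blocks (e : ℕ) where

  m : ℕ
  m = suc (suc (suc e))

  M D : ℤ
  M = + m
  D = + suc (suc e)

  D≡e+2 : D ≡ + e + + 2
  D≡e+2 = trans (sym (+n+1≡+[1+n] (suc e))) (trans (cong (_+ 1ℤ) (sym (+n+1≡+[1+n] e))) (+-assoc (+ e) 1ℤ 1ℤ))

  M≡D+1 : M ≡ D + 1ℤ
  M≡D+1 = sym (+n+1≡+[1+n] (suc (suc e)))

  π : ℕ → ℕ
  π 0             = 1
  π 1             = 0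
  π (suc (suc k)) = suc (suc (e ∸ k))

  π-< : ∀ {r} → r ℕ.< m → π r ℕ.< m
  π-< {0}           _                   = s≤s (s≤s z≤n)
  π-< {1}           _                   = s≤s z≤n
  π-< {suc (suc k)} _                   = s≤s (s≤s (s≤s (ℕ.m∸n≤m e k)))

  π-involutive : ∀ {r} → r ℕ.< m → π (π r) ≡ r
  π-involutive {0}           _                   = refl
  π-involutive {1}           _                   = refl
  π-involutive {suc (suc k)} (s≤s (s≤s (s≤s k≤e))) = cong (λ x → suc (suc x)) (ℕ.m∸[m∸n]≡n k≤e)

  block-< : ∀ {r r′ j j′} → r ℕ.< m → j < j′ → + r + j * M < + r′ + j′ * M
  block-< {r} {r′} {j} {j′} r<m j<j′ = begin-strict
    + r + j * M     <⟨ +-monoˡ-< (j * M) (+<+ r<m) ⟩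
    M + j * M       ≡⟨ suc-* j M ⟨
    ℤ.suc j * M      ≤⟨ *-monoʳ-≤-nonNeg M (i<j⇒suc[i]≤j j<j′) ⟩
    j′ * M          ≤⟨ i≤j+i (j′ * M) (+ r′) ⟩
    + r′ + j′ * M   ∎
    where open ≤-Reasoning

  block-unique : ∀ {r r′ j j′} → r ℕ.< m → r′ ℕ.< m →
    + r + j * M ≡ + r′ + j′ * M → r ≡ r′ × j ≡ j′
  block-unique {r} {r′} {j} {j′} r<m r′<m eq with <-cmp j j′
  ... | tri< j<j′ _ _ = ⊥-elim (<-irrefl eq (block-< r<m j<j′))
  ... | tri> _ _ j′<j = ⊥-elim (<-irrefl (sym eq) (block-< r′<m j′<j))
  ... | tri≈ _ refl _ = +-injective (∙-cancelʳ (j * M) (+ r) (+ r′) eq) , refl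

  ρ : ℤ → ℤ
  ρ t = + π (t %ℕ m) + (t /ℕ m) * M

  ρ-block : ∀ j {r} → r ℕ.< m → ρ (+ r + j * M) ≡ + π r + j * M
  ρ-block j {r} r<m with block-unique {j = t /ℕ m} {j} (n%ℕd<d t m) r<m (sym (a≡a%ℕn+[a/ℕn]*n t m))
    where t = + r + j * M
  ... | r≡ , j≡ = cong₂ (λ r j → + π r + j * M) r≡ j≡

  ρ-involutive : ∀ t → ρ (ρ t) ≡ t
  ρ-involutive t = begin
    ρ (ρ t)                             ≡⟨ ρ-block (t /ℕ m) (π-< r<m) ⟩
    + π (π r) + (t /ℕ m) * M            ≡⟨ cong (λ x → + x + (t /ℕ m) * M) (π-involutive r<m) ⟩
    + r + (t /ℕ m) * M                  ≡⟨ a≡a%ℕn+[a/ℕn]*n t m ⟨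
    t                                   ∎
    where
    open ≡-Reasoning
    r = t %ℕ m
    r<m = n%ℕd<d t m

  next-in-block : ∀ j r → + r + j * M + 1ℤ ≡ + suc r + j * M
  next-in-block j r = trans (swap (+ r) (j * M)) (cong (_+ j * M) (+n+1≡+[1+n] r))
    where swap : ∀ a b → a + b + 1ℤ ≡ a + 1ℤ + b
          swap = solve-∀

  ρ-next : ∀ j {r} → suc r ℕ.< m → ρ (+ r + j * M + 1ℤ) ≡ + π (suc r) + j * M
  ρ-next j {r} r+1<m = trans (cong ρ (next-in-block j r)) (ρ-block j r+1<m)

  Jump : ℤ → Set
  Jump t = ∃[ j ] (ρ t ≡ j * M ⊎ ρ t ≡ j * M + + 2) × ρ (t + 1ℤ) ≡ ρ t + D

  Step : ℤ → Set
  Step t = ρ t ≡ ρ (t + 1ℤ) + 1ℤ ⊎ Jump t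

  descent : ∀ j {r} → suc r ℕ.< m → π r ≡ suc (π (suc r)) → ρ (+ r + j * M) ≡ ρ (+ r + j * M + 1ℤ) + 1ℤ
  descent j {r} r+1<m π-descends = begin
    ρ (+ r + j * M)                ≡⟨ ρ-block j (ℕ.<-trans (ℕ.n<1+n r) r+1<m) ⟩
    + π r + j * M                  ≡⟨ cong (λ x → + x + j * M) π-descends ⟩
    + suc (π (suc r)) + j * M      ≡⟨ next-in-block j (π (suc r)) ⟨
    + π (suc r) + j * M + 1ℤ       ≡⟨ cong (_+ 1ℤ) (ρ-next j r+1<m) ⟨
    ρ (+ r + j * M + 1ℤ) + 1ℤ      ∎
    where open ≡-Reasoning

  step-first : ∀ j → Step (+ 0 + j * M)
  step-first j = inj₁ (descent j (s≤s (s≤s z≤n)) refl)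

  step-second : ∀ j → Step (+ 1 + j * M)
  step-second j = inj₂ (j , inj₁ ρ-at , (begin
    ρ (+ 1 + j * M + 1ℤ)         ≡⟨ ρ-next j (s≤s (s≤s (s≤s z≤n))) ⟩
    D + j * M                    ≡⟨ +-comm D (j * M) ⟩
    j * M + D                    ≡⟨ cong (_+ D) ρ-at ⟨
    ρ (+ 1 + j * M) + D          ∎))
    where
    open ≡-Reasoning
    ρ-at : ρ (+ 1 + j * M) ≡ j * M
    ρ-at = trans (ρ-block j (s≤s (s≤s z≤n))) (+-identityˡ (j * M))

  step-inner : ∀ j {k} → k ℕ.< e → Step (+ suc (suc k) + j * M)
  step-inner j k<e = inj₁ (descent j (s≤s (s≤s (s≤s k<e))) (cong (λ x → suc (suc x)) (ℕ.+-∸-assoc 1 k<e)))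

  step-last : ∀ j → Step (+ suc (suc e) + j * M)
  step-last j = inj₂ (j , inj₂ ρ-at , (begin
    ρ (+ r + j * M + 1ℤ)                 ≡⟨ cong ρ next-block ⟩
    ρ (+ 0 + (j + 1ℤ) * M)               ≡⟨ ρ-block (j + 1ℤ) (s≤s z≤n) ⟩
    + 1 + (j + 1ℤ) * M                   ≡⟨ cong (λ x → + 1 + (j + 1ℤ) * x) M≡D+1 ⟩
    + 1 + (j + 1ℤ) * (D + 1ℤ)            ≡⟨ regroup j D ⟩
    j * (D + 1ℤ) + + 2 + D               ≡⟨ cong (λ x → j * x + + 2 + D) M≡D+1 ⟨
    j * M + + 2 + D                      ≡⟨ cong (_+ D) ρ-at ⟨
    ρ (+ r + j * M) + D                  ∎))
    where
    open ≡-Reasoning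
    r = suc (suc e)
    regroup : ∀ j D → + 1 + (j + 1ℤ) * (D + 1ℤ) ≡ j * (D + 1ℤ) + + 2 + D
    regroup = solve-∀
    ρ-at : ρ (+ r + j * M) ≡ j * M + + 2
    ρ-at = begin
      ρ (+ r + j * M)               ≡⟨ ρ-block j ℕ.≤-refl ⟩
      + suc (suc (e ∸ e)) + j * M   ≡⟨ cong (λ x → + suc (suc x) + j * M) (ℕ.n∸n≡0 e) ⟩
      + 2 + j * M                   ≡⟨ +-comm (+ 2) (j * M) ⟩
      j * M + + 2                   ∎
    next-block : D + j * M + 1ℤ ≡ + 0 + (j + 1ℤ) * M
    next-block = begin
      D + j * M + 1ℤ            ≡⟨ cong (λ x → D + j * x + 1ℤ) M≡D+1 ⟩
      D + j * (D + 1ℤ) + 1ℤ     ≡⟨ next j D ⟩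
      0ℤ + (j + 1ℤ) * (D + 1ℤ)  ≡⟨ cong (λ x → 0ℤ + (j + 1ℤ) * x) M≡D+1 ⟨
      0ℤ + (j + 1ℤ) * M         ∎
      where next : ∀ j D → D + j * (D + 1ℤ) + 1ℤ ≡ 0ℤ + (j + 1ℤ) * (D + 1ℤ)
            next = solve-∀

  ρ-step : ∀ t → Step t
  ρ-step t = subst Step (sym (a≡a%ℕn+[a/ℕn]*n t m)) (by-offset (t /ℕ m) (n%ℕd<d t m))
    where
    by-offset : ∀ j {r} → r ℕ.< m → Step (+ r + j * M)
    by-offset j {0}           _                     = step-first j
    by-offset j {1}           _                     = step-second j
    by-offset j {suc (suc k)} (s≤s (s≤s (s≤s k≤e))) with ℕ.m≤n⇒m<n∨m≡n k≤e
    ... | inj₁ k<e  = step-inner j k<e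
    ... | inj₂ refl = step-last j

  ρ↔ : ℤ ↔ ℤ
  ρ↔ = mk↔ₛ′ ρ ρ ρ-involutive ρ-involutive

  ρ1-ρ2-far : ¬ Adj P∞ (ρ 1ℤ) (ρ (+ 2))
  ρ1-ρ2-far ()

module UniquePath (X : Graph) (p : HamPath X) (unique : ∀ q → SamePath p q)
                  (vt : VertexTransitive X) where

  w : ℤ → V X
  w = walk p

  infix 4 _∼_
  _∼_ : ℤ → ℤ → Set
  i ∼ j = Adj X (w i) (w j)

  ∼-cong : ∀ {i i′ j j′} → i ≡ i′ → j ≡ j′ → i ∼ j → i′ ∼ j′
  ∼-cong refl refl i∼j = i∼j

  ∼-sym : ∀ {i j} → i ∼ j → j ∼ i
  ∼-sym = Graph.sym X

  pathEdge⇔adjacent : ∀ i j → PathEdge p (w i) (w j) ⇔ Adj P∞ i j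
  pathEdge⇔adjacent i j = subst₂ (λ a b → PathEdge p (w i) (w j) ⇔ Adj P∞ a b)
    (index∘walk p i) (index∘walk p j) (pathEdge⇔adj-index p (w i) (w j))

  adjacent⇒∼ : ∀ {i j} → Adj P∞ i j → i ∼ j
  adjacent⇒∼ {i} {j} = pathEdge⇒adj p ∘ Equivalence.from (pathEdge⇔adjacent i j)

  Symmetry : (ℤ → ℤ) → Set
  Symmetry f = ∀ {i j} → i ∼ j → f i ∼ f j

  symmetry-ext : ∀ {f g} → (∀ t → f t ≡ g t) → Symmetry f → Symmetry g
  symmetry-ext f≗g sym-f = ∼-cong (f≗g _) (f≗g _) ∘ sym-f

  -- An automorphism a moves p to the hamiltonian path a ∘ p, which by uniqueness has the
  -- same edges as p; read through p it is therefore a hamiltonian path of P∞, i.e. rigid.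
  automorphism-rigid : (a : Automorphism X) →
    let f = index p ∘ Bijection.to (σ a) ∘ w in Symmetry f × Rigid f
  automorphism-rigid a = symmetric , injective-unit-steps⇒rigid (proj₁ (bijective q)) (adjacent q)
    where
    q = relabel p (mapHamPath a p) (unique (mapHamPath a p))
    symmetric : Symmetry (index p ∘ Bijection.to (σ a) ∘ w)
    symmetric {i} {j} i∼j = subst₂ (Adj X) (sym (walk∘index p _)) (sym (walk∘index p _))
      (Equivalence.to (preserve a (w i) (w j)) i∼j)

  translation-or-reflection : ∀ n → Symmetry (_+_ n) ⊎ Symmetry (_-_ n)
  translation-or-reflection n with vt (w 0ℤ) (w n)
  ... | a , a0≡n with automorphism-rigid a
  ...   | symmetric , inj₁ shift = inj₁ (symmetry-ext (λ t → trans (shift t) (cong (_+ t) f0≡n)) symmetric)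
    where f0≡n = trans (cong (index p) a0≡n) (index∘walk p n)
  ...   | symmetric , inj₂ flip  = inj₂ (symmetry-ext (λ t → trans (flip t) (cong (_- t) f0≡n)) symmetric)
    where f0≡n = trans (cong (index p) a0≡n) (index∘walk p n)

  translation-twice : ∀ {n} → Symmetry (_+_ n) → Symmetry (_+_ (n + n))
  translation-twice {n} shift = symmetry-ext (double n) (shift ∘ shift)
    where double : ∀ n t → n + (n + t) ≡ n + n + t
          double = solve-∀

  even-translation : ∀ n → Symmetry (_+_ (n + n))
  even-translation n with translation-or-reflection n | translation-or-reflection (n + n)
  ... | inj₁ shift  | _            = translation-twice {n} shift
  ... | inj₂ _      | inj₁ shift   = shift
  ... | inj₂ flip₁  | inj₂ flip₂   = translation-twice {n} (symmetry-ext (reflections n) (flip₂ ∘ flip₁))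
    where reflections : ∀ n t → n + n - (n - t) ≡ n + t
          reflections = solve-∀

  long-edge-translate : ∀ {D x y} n → n + n + x ≡ y → x ∼ (x + D) → y ∼ (y + D)
  long-edge-translate {D} {x} n eq long =
    ∼-cong eq (trans (sym (+-assoc (n + n) x D)) (cong (_+ D) eq)) (even-translation n long)

  edges-everywhere : ∀ {D c} → c ∼ (c + D) → (c + 1ℤ) ∼ (c + 1ℤ + D) → ∀ t → t ∼ (t + D)
  edges-everywhere {D} {c} at-c at-c+1 t with even-or-odd (t - c)
  ... | n , inj₁ t-c≡2n   = long-edge-translate n (i-j≡k⇒k+j≡i t-c≡2n) at-c
  ... | n , inj₂ t-c≡2n+1 = long-edge-translate n (trans (regroup (n + n) c) (i-j≡k⇒k+j≡i t-c≡2n+1)) at-c+1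
    where regroup : ∀ a c → a + (c + 1ℤ) ≡ a + 1ℤ + c
          regroup = solve-∀

  -- The reflection t ↦ 1 - t moves the edge at c to one starting at 1 - c - D, which has
  -- the other parity when D is even.
  even-length-edge-shifts : ∀ {D c k} → D ≡ k + k → c ∼ (c + D) → (c + 1ℤ) ∼ (c + 1ℤ + D)
  even-length-edge-shifts {D} {c} {k} refl long with translation-or-reflection 1ℤ
  ... | inj₁ shift = ∼-cong (+-comm 1ℤ c) (regroup c D) (shift long)
    where regroup : ∀ c D → 1ℤ + (c + D) ≡ c + 1ℤ + D
          regroup = solve-∀
  ... | inj₂ flip  = ∼-cong (back c k) (forth c k) (even-translation (c + k) (∼-sym (flip long)))
    where
    back : ∀ c k → c + k + (c + k) + (1ℤ - (c + (k + k))) ≡ c + 1ℤ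
    back = solve-∀
    forth : ∀ c k → c + k + (c + k) + (1ℤ - c) ≡ c + 1ℤ + (k + k)
    forth = solve-∀

  module _ (e : ℕ) where
    open Blocks e

    periodic-path : ∀ c → (∀ j → (c + j * M) ∼ (c + j * M + D)) → HamPath X
    periodic-path c long = hamPath (walk↔ p ↔-∘ (⤖⇒↔ (σ (translation c)) ↔-∘ ρ↔)) step
      where
      jump-edge : ∀ {t x} → x ∼ (x + D) → x ≡ ρ t + c → ρ (t + 1ℤ) ≡ ρ t + D → (ρ t + c) ∼ (ρ (t + 1ℤ) + c)
      jump-edge {t} {x} edge refl next = ∼-cong refl (sym (trans (cong (_+ c) next) (regroup (ρ t) D c))) edge
        where regroup : ∀ a D c → a + D + c ≡ a + c + D
              regroup = solve-∀
      step : ∀ t → (ρ t + c) ∼ (ρ (t + 1ℤ) + c)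
      step t with ρ-step t
      ... | inj₁ descent = adjacent⇒∼ (Equivalence.to (preserve (translation c) (ρ t) (ρ (t + 1ℤ)))
                              (subst (λ x → Adj P∞ x (ρ (t + 1ℤ))) (sym descent) (P∞-adj-prev (ρ (t + 1ℤ)))))
      ... | inj₂ (j , inj₁ at-jM , next)   =
        jump-edge {t} (long j) (trans (+-comm c (j * M)) (cong (_+ c) (sym at-jM))) next
      ... | inj₂ (j , inj₂ at-jM+2 , next) =
        jump-edge {t} (long-edge-translate 1ℤ (trans (regroup c (j * M)) (cong (_+ c) (sym at-jM+2))) (long j)) refl next
        where regroup : ∀ c J → 1ℤ + 1ℤ + (c + J) ≡ J + + 2 + c
              regroup = solve-∀

    -- The periodic path joins ρ 1 = 0 and ρ 2 = D, which are not consecutive in p.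
    no-periodic-long-edges : ∀ c → ¬ (∀ j → (c + j * M) ∼ (c + j * M + D))
    no-periodic-long-edges c long = ρ1-ρ2-far
      (Equivalence.from (preserve (translation c) (ρ 1ℤ) (ρ (+ 2)))
        (Equivalence.to (pathEdge⇔adjacent _ _)
          (Equivalence.from (unique (periodic-path c long) _ _) (1ℤ , inj₁ (refl , refl)))))

    -- For even e the long edges occur at every start; for odd e the block length M is even,
    -- so every block start c + j M is an even translate of c.
    no-long-edge : ∀ {c} → ¬ c ∼ (c + D)
    no-long-edge {c} long with even-or-odd (+ e)
    ... | n , inj₁ e≡2n   = no-periodic-long-edges c λ j → edges-everywhere long
                              (even-length-edge-shifts {k = n + 1ℤ} D≡2[n+1] long) (c + j * M)
      where
      D≡2[n+1] : D ≡ (n + 1ℤ) + (n + 1ℤ)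
      D≡2[n+1] = trans D≡e+2 (trans (cong (_+ + 2) e≡2n) (regroup n))
        where regroup : ∀ n → n + n + + 2 ≡ (n + 1ℤ) + (n + 1ℤ)
              regroup = solve-∀
    ... | n , inj₂ e≡2n+1 = no-periodic-long-edges c λ j →
                              long-edge-translate (j * (n + + 2)) (shift j) long
      where
      M≡2[n+2] : M ≡ (n + + 2) + (n + + 2)
      M≡2[n+2] = trans M≡D+1 (trans (cong (_+ 1ℤ) (trans D≡e+2 (cong (_+ + 2) e≡2n+1))) (regroup n))
        where regroup : ∀ n → n + n + 1ℤ + + 2 + 1ℤ ≡ (n + + 2) + (n + + 2)
              regroup = solve-∀
      shift : ∀ j → j * (n + + 2) + j * (n + + 2) + c ≡ c + j * M
      shift j = trans (regroup j (n + + 2) c) (cong (λ x → c + j * x) (sym M≡2[n+2]))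
        where regroup : ∀ j h c → j * h + j * h + c ≡ c + j * (h + h)
              regroup = solve-∀

  ∼⇒adjacent : ∀ {i j} → i ∼ j → Adj P∞ i j
  ∼⇒adjacent {i} {j} i∼j = by-gap (j - i) refl
    where
    j≡i+gap : ∀ i j → j ≡ i + (j - i)
    j≡i+gap = solve-∀
    i≡j+[-gap] : ∀ i j → i ≡ j + - (j - i)
    i≡j+[-gap] = solve-∀
    by-gap : ∀ d → j - i ≡ d → Adj P∞ i j
    by-gap (+ 0)           gap = ⊥-elim (Graph.irrefl X (∼-cong refl (i-j≡0⇒i≡j j i gap) i∼j))
    by-gap (+ 1)           gap = trans (∣i-j∣≡∣j-i∣ i j) (cong ∣_∣ gap)
    by-gap -[1+ 0 ]        gap = trans (∣i-j∣≡∣j-i∣ i j) (cong ∣_∣ gap)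
    by-gap (+ suc (suc e)) gap =
      ⊥-elim (no-long-edge e (∼-cong refl (trans (j≡i+gap i j) (cong (_+_ i) gap)) i∼j))
    by-gap -[1+ suc e ]    gap =
      ⊥-elim (no-long-edge e (∼-cong refl (trans (i≡j+[-gap] i j) (cong (λ d → j + - d) gap)) (∼-sym i∼j)))

  isomorphism : X ≅ P∞
  isomorphism = record
    { iso = ↔⇒⤖ (↔-sym (walk↔ p))
    ; preserve = λ u v → mk⇔
        (λ adj → ∼⇒adjacent (subst₂ (Adj X) (sym (walk∘index p u)) (sym (walk∘index p v)) adj))
        (pathEdge⇒adj p ∘ Equivalence.from (pathEdge⇔adj-index p u v))
    }

-- A hamiltonian path is a bijection ℤ → V, so countability of X is automatic.
proposition1p4 : (VertexTransitive P∞ × UniqueHamPath P∞)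
    × (∀ (X : Graph) → CountablyInfinite X → VertexTransitive X → UniqueHamPath X → X ≅ P∞)
proposition1p4 = (P∞-vertexTransitive , P∞-uniqueHamPath) ,
  λ X _ vt (p , unique) → UniquePath.isomorphism X p unique vt
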